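{- Let $C$ be a list of deducibility constraints and suppose $C\leadsto_\theta C'$. If $C'$ is satisfiable then $C$ is satisfiable; moreover, if $\sigma$ is a solution for $C'$ then $\theta\circ\sigma$ is a solution for $C$.
   Context: Messages are built from names and variables using only pairing $\langle M,N\rangle$ and symmetric encryption $\{M\}_N$; equality is syntactic. Sequent rules ($\Gamma,M$ means $\Gamma\cup\{M\}$): (id) $\Gamma\vdash M$ if $M\in\Gamma$; ($p_L$) from $\Gamma,\langle M,N\rangle,M,N\vdash T$ infer $\Gamma,\langle M,N\rangle\vdash T$; ($p_R$) from $\Gamma\vdash M,\Gamma\vdash N$ infer $\Gamma\vdash\langle M,N\rangle$; ($e_L$) from $\Gamma,\{M\}_K\vdash K$ and $\Gamma,\{M\}_K,M,K\vdash N$ infer $\Gamma,\{M\}_K\vdash N$; ($e_R$) from $\Gamma\vdash M,\Gamma\vdash K$ infer $\Gamma\vdash\{M\}_K$. $\Gamma\Vdash M$: derivable; $\Gamma\Vdash_RM$: derivable using only id, $p_R$, $e_R$. A deducibility constraint is $\Sigma\Vdash^?M$ (proper) or $\Sigma\Vdash^?_RM$ (right). Substitutions are applied postfix; composition $M(\theta\circ\rho)=(M\theta)\rho$; $\epsilon$ is the identity. A ground substitution $\theta$ is a solution of a list $C$ of constraints if $\Sigma\theta\Vdash M\theta$ for each proper and $\Sigma\theta\Vdash_RM\theta$ for each right constraint in $C$; $C$ is satisfiable if it has a solution. Reductions ($\leadsto$ means $\leadsto_\epsilon$; $C_1,C_2$ arbitrary lists): C1: $C_1;\Sigma\Vdash^?_RM;C_2\leadsto_\theta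 C_1\theta;C_2\theta$ if $M$ is not a variable and $\theta=mgu(M,N)$ for some $N\in\Sigma$; C2: $C_1;\Sigma\Vdash^?_Rf(M,N);C_2\leadsto C_1;\Sigma\Vdash^?_RM;\Sigma\Vdash^?_RN;C_2$ ($f$ pairing or encryption); C3: $C_1;\Sigma\Vdash^?M;C_2\leadsto C_1;\Sigma\Vdash^?_RM;C_2$; C4: $C_1;(\Sigma,\langle M,N\rangle\Vdash^?U);C_2\leadsto C_1;(\Sigma,M,N\Vdash^?U);C_2$ if $\langle M,N\rangle\notin\Sigma$; C5: $C_1;(\Sigma,\{M\}_N\Vdash^?U);C_2\leadsto C_1;(\Sigma,\{M\}_N\Vdash^?_RN);(\Sigma,M,N\Vdash^?U);C_2$ if $\{M\}_N\notin\Sigma$. -}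

module Defs where

open import Data.Nat using (ℕ)
open import Data.List using (List; []; _∷_; _++_; map)
open import Data.List.Membership.Propositional using (_∈_; _∉_)
open import Data.List.Relation.Unary.All using (All)
open import Data.Product using (Σ; ∃; _×_; _,_)
open import Relation.Binary.PropositionalEquality using (_≡_)
open import Relation.Nullary using (¬_)

-- Messages: names and variables, closed under pairing and symmetric
-- encryption.  Equality is syntactic (Agda's _≡_).

data Msg : Set where
  name : ℕ → Msg
  var  : ℕ → Msg
  ⟨_,_⟩ : Msg → Msg → Msg
  enc  : Msg → Msg → Msg      -- enc M K  is  {M}_K

IsVar : Msg → Set
IsVar M = ∃ λ x → M ≡ var x

data Ground : Msg → Set where
  name : ∀ n → Ground (name n)
  pair : ∀ {M N} → Ground M → Ground N → Ground ⟨ M , N ⟩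
  enc  : ∀ {M K} → Ground M → Ground K → Ground (enc M K)

Subst : Set
Subst = ℕ → Msg

_[_] : Msg → Subst → Msg
name n    [ θ ] = name n
var x     [ θ ] = θ x
⟨ M , N ⟩ [ θ ] = ⟨ M [ θ ] , N [ θ ] ⟩
enc M K   [ θ ] = enc (M [ θ ]) (K [ θ ])

ε : Subst
ε = var

-- composition:  M (θ ∘ σ) = (M θ) σ
_∘ˢ_ : Subst → Subst → Subst
(θ ∘ˢ σ) x = θ x [ σ ]

GroundSubst : Subst → Set
GroundSubst σ = ∀ x → Ground (σ x)

IsMGU : Subst → Msg → Msg → Set
IsMGU θ M N =
  (M [ θ ] ≡ N [ θ ]) ×
  (∀ (ρ : Subst) → M [ ρ ] ≡ N [ ρ ] → Σ Subst λ δ → ∀ x → ρ x ≡ θ x [ δ ])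

-- Sequent calculus.  A set Γ of messages is represented by a list;
-- Γ,M is  M ∷ Γ  and all rules only use membership, so derivability
-- depends only on the underlying set.

infix 4 _⊩_ _⊩R_

data _⊩_ (Γ : List Msg) : Msg → Set where
  id : ∀ {M} → M ∈ Γ → Γ ⊩ M
  pL : ∀ {M N T} → ⟨ M , N ⟩ ∈ Γ → (M ∷ N ∷ Γ) ⊩ T → Γ ⊩ T
  pR : ∀ {M N} → Γ ⊩ M → Γ ⊩ N → Γ ⊩ ⟨ M , N ⟩
  eL : ∀ {M K N} → enc M K ∈ Γ → Γ ⊩ K → (M ∷ K ∷ Γ) ⊩ N → Γ ⊩ N
  eR : ∀ {M K} → Γ ⊩ M → Γ ⊩ K → Γ ⊩ enc M K

data _⊩R_ (Γ : List Msg) : Msg → Set where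
  id : ∀ {M} → M ∈ Γ → Γ ⊩R M
  pR : ∀ {M N} → Γ ⊩R M → Γ ⊩R N → Γ ⊩R ⟨ M , N ⟩
  eR : ∀ {M K} → Γ ⊩R M → Γ ⊩R K → Γ ⊩R enc M K

data Kind : Set where
  proper right : Kind

record Constraint : Set where
  constructor con
  field
    kind : Kind
    lhs  : List Msg
    rhs  : Msg

_⊩?_ : List Msg → Msg → Constraint
Γ ⊩? M = con proper Γ M

_⊩?R_ : List Msg → Msg → Constraint
Γ ⊩?R M = con right Γ M

substC : Subst → Constraint → Constraint
substC θ (con k Γ M) = con k (map (_[ θ ]) Γ) (M [ θ ])

substCs : Subst → List Constraint → List Constraint
substCs θ = map (substC θ)

SatC : Subst → Constraint → Set
SatC σ (con proper Γ M) = map (_[ σ ]) Γ ⊩  (M [ σ ])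
SatC σ (con right  Γ M) = map (_[ σ ]) Γ ⊩R (M [ σ ])

IsSolution : Subst → List Constraint → Set
IsSolution σ C = GroundSubst σ × All (SatC σ) C

Satisfiable : List Constraint → Set
Satisfiable C = Σ Subst λ σ → IsSolution σ C

SameSet : List Msg → List Msg → Set
SameSet Γ Δ = ∀ x → (x ∈ Γ → x ∈ Δ) × (x ∈ Δ → x ∈ Γ)

infix 3 _↝[_]_

data _↝[_]_ : List Constraint → Subst → List Constraint → Set where
  C1 : ∀ C₁ C₂ Γ M N θ → ¬ IsVar M → N ∈ Γ → IsMGU θ M N →
       (C₁ ++ (Γ ⊩?R M) ∷ C₂) ↝[ θ ] (substCs θ C₁ ++ substCs θ C₂)
  C2-pair : ∀ C₁ C₂ Γ M N →
       (C₁ ++ (Γ ⊩?R ⟨ M , N ⟩) ∷ C₂) ↝[ ε ] (C₁ ++ (Γ ⊩?R M) ∷ (Γ ⊩?R N) ∷ C₂)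
  C2-enc : ∀ C₁ C₂ Γ M N →
       (C₁ ++ (Γ ⊩?R enc M N) ∷ C₂) ↝[ ε ] (C₁ ++ (Γ ⊩?R M) ∷ (Γ ⊩?R N) ∷ C₂)
  C3 : ∀ C₁ C₂ Γ M →
       (C₁ ++ (Γ ⊩? M) ∷ C₂) ↝[ ε ] (C₁ ++ (Γ ⊩?R M) ∷ C₂)
  C4 : ∀ C₁ C₂ Γ Σ' M N U → SameSet Γ (⟨ M , N ⟩ ∷ Σ') → ⟨ M , N ⟩ ∉ Σ' →
       (C₁ ++ (Γ ⊩? U) ∷ C₂) ↝[ ε ] (C₁ ++ ((M ∷ N ∷ Σ') ⊩? U) ∷ C₂)
  C5 : ∀ C₁ C₂ Γ Σ' M N U → SameSet Γ (enc M N ∷ Σ') → enc M N ∉ Σ' →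
       (C₁ ++ (Γ ⊩? U) ∷ C₂) ↝[ ε ]
       (C₁ ++ (Γ ⊩?R N) ∷ ((M ∷ N ∷ Σ') ⊩? U) ∷ C₂)

module Submission where

-- The proof is local.  Every reduction rewrites one constraint c of the list
-- C₁ ; c ; C₂ into a short list Ys of new constraints (rule C1 additionally
-- instantiates C₁ and C₂ by θ).  So it suffices to know
--   * substitution lemma: σ satisfies c θ iff θ ∘ σ satisfies c, because
--     (M θ) σ = M (θ ∘ σ); this handles the instantiated context of C1;
--   * for each rule, the replaced constraint follows from its replacements:
--     C1 by the id rule (M θ = N θ with N ∈ Σ), C2 by p_R / e_R, C3 because
--     ⊩_R is a restriction of ⊩, and C4 / C5 by p_L / e_L after weakening
--     Σ, M, N back into the original left-hand side;
--   * a splicing lemma putting the local step back into C₁ ; _ ; C₂.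
-- For the ε-rules, ε ∘ σ is definitionally σ, so no transport is needed.
-- Groundness of θ ∘ σ follows since ground substitutions keep terms ground.

open import Defs
open import Data.List using (List; []; _∷_; _++_; map)
open import Data.List.Properties using (map-cong; map-∘)
open import Data.List.Membership.Propositional using (_∈_)
open import Data.List.Membership.Propositional.Properties using (∈-map⁺)
open import Data.List.Relation.Binary.Subset.Propositional using (_⊆_)
open import Data.List.Relation.Binary.Subset.Propositional.Properties
  using (∷⁺ʳ) renaming (map⁺ to map-⊆)
open import Data.List.Relation.Unary.Any using (here; there)
open import Data.List.Relation.Unary.All as All using (All; []; _∷_)
open import Data.List.Relation.Unary.All.Properties using (++⁺; ++⁻; map⁻)
open import Data.Product using (_×_; _,_; proj₂)
open import Relation.Binary.PropositionalEquality
  using (_≡_; refl; sym; trans; cong₂)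

subst-∘ : ∀ θ σ M → M [ θ ∘ˢ σ ] ≡ (M [ θ ]) [ σ ]
subst-∘ θ σ (name n)  = refl
subst-∘ θ σ (var x)   = refl
subst-∘ θ σ ⟨ M , N ⟩ = cong₂ ⟨_,_⟩ (subst-∘ θ σ M) (subst-∘ θ σ N)
subst-∘ θ σ (enc M K) = cong₂ enc (subst-∘ θ σ M) (subst-∘ θ σ K)

map-subst-∘ : ∀ θ σ Γ → map (_[ θ ∘ˢ σ ]) Γ ≡ map (_[ σ ]) (map (_[ θ ]) Γ)
map-subst-∘ θ σ Γ = trans (map-cong (subst-∘ θ σ) Γ) (map-∘ Γ)

ground-[] : ∀ {σ} → GroundSubst σ → ∀ M → Ground (M [ σ ])
ground-[] g (name n)  = name n
ground-[] g (var x)   = g x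
ground-[] g ⟨ M , N ⟩ = pair (ground-[] g M) (ground-[] g N)
ground-[] g (enc M K) = enc (ground-[] g M) (ground-[] g K)

ground-∘ : ∀ θ {σ} → GroundSubst σ → GroundSubst (θ ∘ˢ σ)
ground-∘ θ g x = ground-[] g (θ x)

sat-substC : ∀ θ σ c → SatC σ (substC θ c) → SatC (θ ∘ˢ σ) c
sat-substC θ σ (con proper Γ M) s
  rewrite map-subst-∘ θ σ Γ | subst-∘ θ σ M = s
sat-substC θ σ (con right Γ M) s
  rewrite map-subst-∘ θ σ Γ | subst-∘ θ σ M = s

sat-substCs : ∀ θ σ C → All (SatC σ) (substCs θ C) → All (SatC (θ ∘ˢ σ)) C
sat-substCs θ σ C s = All.map (λ {c} → sat-substC θ σ c) (map⁻ s)

⊩R⇒⊩ : ∀ {Γ M} → Γ ⊩R M → Γ ⊩ M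
⊩R⇒⊩ (id M∈Γ) = id M∈Γ
⊩R⇒⊩ (pR d e)  = pR (⊩R⇒⊩ d) (⊩R⇒⊩ e)
⊩R⇒⊩ (eR d e)  = eR (⊩R⇒⊩ d) (⊩R⇒⊩ e)

weaken : ∀ {Γ Δ T} → Γ ⊆ Δ → Γ ⊩ T → Δ ⊩ T
weaken Γ⊆Δ (id T∈Γ)   = id (Γ⊆Δ T∈Γ)
weaken Γ⊆Δ (pL p d)   = pL (Γ⊆Δ p) (weaken (∷⁺ʳ _ (∷⁺ʳ _ Γ⊆Δ)) d)
weaken Γ⊆Δ (pR d e)   = pR (weaken Γ⊆Δ d) (weaken Γ⊆Δ e)
weaken Γ⊆Δ (eL e k d) = eL (Γ⊆Δ e) (weaken Γ⊆Δ k) (weaken (∷⁺ʳ _ (∷⁺ʳ _ Γ⊆Δ)) d)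
weaken Γ⊆Δ (eR d e)   = eR (weaken Γ⊆Δ d) (weaken Γ⊆Δ e)

pL-sub : ∀ {Σ Δ M N T} → ⟨ M , N ⟩ ∈ Δ → Σ ⊆ Δ → (M ∷ N ∷ Σ) ⊩ T → Δ ⊩ T
pL-sub p Σ⊆Δ d = pL p (weaken (∷⁺ʳ _ (∷⁺ʳ _ Σ⊆Δ)) d)

eL-sub : ∀ {Σ Δ M K T} → enc M K ∈ Δ → Σ ⊆ Δ → Δ ⊩ K →
         (M ∷ K ∷ Σ) ⊩ T → Δ ⊩ T
eL-sub e Σ⊆Δ k d = eL e k (weaken (∷⁺ʳ _ (∷⁺ʳ _ Σ⊆Δ)) d)

sameSet-split : ∀ {Γ Σ a} σ → SameSet Γ (a ∷ Σ) →
  (a [ σ ]) ∈ map (_[ σ ]) Γ × map (_[ σ ]) Σ ⊆ map (_[ σ ]) Γ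
sameSet-split σ same =
  ∈-map⁺ (_[ σ ]) (proj₂ (same _) (here refl)) ,
  map-⊆ (_[ σ ]) (λ x∈Σ → proj₂ (same _) (there x∈Σ))

splice : ∀ {P : Constraint → Set} C₁ C₂ {X} Ys →
  (All P Ys → P X) → All P (C₁ ++ Ys ++ C₂) → All P (C₁ ++ X ∷ C₂)
splice C₁ C₂ Ys Ys⇒X s with ++⁻ C₁ s
... | s₁ , s' with ++⁻ Ys s'
...   | sYs , s₂ = ++⁺ s₁ (Ys⇒X sYs ∷ s₂)

reduction-sound : ∀ {C C' θ} → C ↝[ θ ] C' →
  ∀ σ → All (SatC σ) C' → All (SatC (θ ∘ˢ σ)) C
reduction-sound (C1 C₁ C₂ Γ M N θ _ N∈Γ (Mθ≡Nθ , _)) σ s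
  with ++⁻ (substCs θ C₁) s
... | s₁ , s₂ = ++⁺ (sat-substCs θ σ C₁ s₁) (unified ∷ sat-substCs θ σ C₂ s₂)
  where
  -- M (θ ∘ σ) = N (θ ∘ σ), and N (θ ∘ σ) is among the hypotheses.
  unified : map (_[ θ ∘ˢ σ ]) Γ ⊩R (M [ θ ∘ˢ σ ])
  unified rewrite subst-∘ θ σ M | Mθ≡Nθ | sym (subst-∘ θ σ N) =
    id (∈-map⁺ (_[ θ ∘ˢ σ ]) N∈Γ)
reduction-sound (C2-pair C₁ C₂ Γ M N) σ =
  splice C₁ C₂ (_ ∷ _ ∷ []) λ { (dM ∷ dN ∷ []) → pR dM dN }
reduction-sound (C2-enc C₁ C₂ Γ M N) σ =
  splice C₁ C₂ (_ ∷ _ ∷ []) λ { (dM ∷ dN ∷ []) → eR dM dN }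
reduction-sound (C3 C₁ C₂ Γ M) σ =
  splice C₁ C₂ (_ ∷ []) λ { (d ∷ []) → ⊩R⇒⊩ d }
reduction-sound (C4 C₁ C₂ Γ Σ' M N U same _) σ
  with sameSet-split σ same
... | pair∈Γ , Σ'⊆Γ =
  splice C₁ C₂ (_ ∷ []) λ { (d ∷ []) → pL-sub pair∈Γ Σ'⊆Γ d }
reduction-sound (C5 C₁ C₂ Γ Σ' M N U same _) σ
  with sameSet-split σ same
... | enc∈Γ , Σ'⊆Γ =
  splice C₁ C₂ (_ ∷ _ ∷ []) λ { (dN ∷ d ∷ []) → eL-sub enc∈Γ Σ'⊆Γ (⊩R⇒⊩ dN) d }

lemma6p7 : (C C' : List Constraint) (θ : Subst) → C ↝[ θ ] C' →
    (Satisfiable C' → Satisfiable C) ×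
    (∀ (σ : Subst) → IsSolution σ C' → IsSolution (θ ∘ˢ σ) C)
lemma6p7 C C' θ step = (λ { (σ , sol) → θ ∘ˢ σ , lift σ sol }) , lift
  where
  lift : ∀ σ → IsSolution σ C' → IsSolution (θ ∘ˢ σ) C
  lift σ (ground , sat) = ground-∘ θ ground , reduction-sound step σ sat
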